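{- Let $t\in\mathsf{Tid}$, $x\in{\sf Var_G}$, $\sigma_0\in I_{PP}$ and $\sigma\in\Sigma_{PP}$ with $\sigma_0\overset{\alpha}{\Rightarrow}\sigma$ for some $\alpha\in traces(TS_{PP})$. If $q=ts(last(\sigma.wb^{t,x}))$, then $\forall t'\in\mathsf{Tid}\ \forall x'\in{\sf Var_G}$ with $t'\neq t\lor x'\neq x$: $(\cdot,q)\notin\sigma.wb^{t',x'}$, and for all $(\cdot,q')\in\sigma.wb^{t,x}$ with $(\cdot,q')\neq last(\sigma.wb^{t,x})$: $q>q'$.
   Context: PPSO (prophetic PSO): states $\sigma=(s,wb)\in\Sigma_{PP}$ with shared memory $s:{\sf Var_G}\to{\sf Val}$ and, for each thread $t$ and global variable $x$, a FIFO buffer $wb^{t,x}\in({\sf Val}\times\mathbb{Q})^*$ of (value, timestamp) pairs; $ts(\cdot)$ gives the timestamp of an entry. PP-Write: $wr(x,v)$ by $t$ appends $(v,q)$ to $wb^{t,x}$ provided $q$ occurs as timestamp in no buffer and exceeds all timestamps in $wb^{t,x}$. PP-Read and PP-Fence leave the state unchanged (reads return the last entry of $wb^{t,x}$ if nonempty, else $s(x)$; a fence requires all buffers of $t$ empty). PP-Flush of $t$: if $wb^{t,x}=\langle(v,q)\rangle\cdot w$ and $q$ is smaller than every timestamp in every other buffer, set $s(x):=v$, $wb^{t,x}:=w$. $I_{PP}$: all buffers empty. $FL_{PP}=(\bigcup_t\overset{flush,t}{\leadsto}_{PP})^*$, $T_{PP}(t,a)=FL_{PP}\,;\,\overset{a,t}{\leadsto}_{PP}$,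 where $;$ denotes relational composition. $\sigma_0\overset{\alpha}{\Rightarrow}\sigma$ for $\alpha=a_1\dots a_n$ means $(\sigma_0,\sigma)\in T_{PP}(t_1,a_1)\,;\dots;\,T_{PP}(t_n,a_n)$ for some threads $t_i$; $traces(TS_{PP})$ are the action sequences reachable this way from initial states. -}

module Defs where

open import Data.Bool using (Bool; true; false; if_then_else_; _∧_)
open import Data.List using (List; []; _∷_; _++_; [_])
open import Data.List.Membership.Propositional using (_∈_; _∉_)
open import Data.Product using (_×_; _,_; proj₁; proj₂; ∃; ∃-syntax; Σ)
open import Data.Sum using (_⊎_)
open import Data.Rational using (ℚ; _<_)
open import Relation.Binary.Definitions using (DecidableEquality)
open import Relation.Binary.PropositionalEquality using (_≡_; _≢_)
open import Relation.Nullary.Decidable using (⌊_⌋)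
open import Relation.Binary.Construct.Closure.ReflexiveTransitive using (Star)

record Setting : Set₁ where
  field
    Tid  : Set
    VarG : Set
    Val  : Set
    _≟t_ : DecidableEquality Tid
    _≟x_ : DecidableEquality VarG

module PPSO (S : Setting) where
  open Setting S public

  Entry : Set
  Entry = Val × ℚ

  ts : Entry → ℚ
  ts = proj₂

  record State : Set where
    constructor ⟨_,_⟩
    field
      s  : VarG → Val
      wb : Tid → VarG → List Entry
  open State public

  data Act : Set where
    wr    : VarG → Val → Act
    rd    : VarG → Val → Act
    fence : Act

  updS : (VarG → Val) → VarG → Val → (VarG → Val)
  updS m x v y = if ⌊ y ≟x x ⌋ then v else m y

  updWB : (Tid → VarG → List Entry) → Tid → VarG → List Entry
        → (Tid → VarG → List Entry)
  updWB b t x w t' y = if ⌊ t' ≟t t ⌋ ∧ ⌊ y ≟x x ⌋ then w else b t' y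

  readVal : State → Tid → VarG → Val
  readVal σ t x = go (wb σ t x)
    where
      go : List Entry → Val
      go [] = s σ x
      go (e ∷ []) = proj₁ e
      go (_ ∷ e′ ∷ es) = go (e′ ∷ es)

  I : State → Set
  I σ = ∀ t x → wb σ t x ≡ []

  data Step (t : Tid) : Act → State → State → Set where
    pp-write : ∀ {σ x v} (q : ℚ)
      → (∀ t' x' v' → (v' , q) ∉ wb σ t' x')
      → (∀ e → e ∈ wb σ t x → ts e < q)
      → Step t (wr x v) σ ⟨ s σ , updWB (wb σ) t x (wb σ t x ++ [ (v , q) ]) ⟩
    pp-read : ∀ {σ x v}
      → v ≡ readVal σ t x
      → Step t (rd x v) σ σ
    pp-fence : ∀ {σ}
      → (∀ x → wb σ t x ≡ [])
      → Step t fence σ σ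

  data Flush (t : Tid) : State → State → Set where
    pp-flush : ∀ {σ x v q w}
      → wb σ t x ≡ (v , q) ∷ w
      → (∀ t' x' → (t' ≢ t ⊎ x' ≢ x) → ∀ e → e ∈ wb σ t' x' → q < ts e)
      → Flush t σ ⟨ updS (s σ) x v , updWB (wb σ) t x w ⟩

  FlushAny : State → State → Set
  FlushAny σ σ' = ∃[ t ] Flush t σ σ'

  FL : State → State → Set
  FL = Star FlushAny

  T : Tid → Act → State → State → Set
  T t a σ σ' = ∃[ σm ] (FL σ σm × Step t a σm σ')

  data Run : State → List Act → State → Set where
    done : ∀ {σ} → Run σ [] σ
    step : ∀ {σ σ₁ σ₂ a α} (t : Tid) → T t a σ σ₁ → Run σ₁ α σ₂ → Run σ (a ∷ α) σ₂

  traces : List Act → Set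
  traces α = ∃[ σ₀ ] ∃[ σ ] (I σ₀ × Run σ₀ α σ)

-- Every reachable state keeps two invariants on its write buffers: each
-- buffer is strictly increasing in timestamps, and a timestamp occurs in at
-- most one buffer. A write appends a timestamp that is fresh and larger than
-- those of its own buffer, and a flush only deletes entries, so both survive
-- every step. The last entry of a buffer is then its unique maximum, and its
-- timestamp occurs in no other buffer.
module Submission where

open import Defs
open import Data.List using (List; last; []; _∷_; _++_; [_])
open import Data.List.Membership.Propositional using (_∈_; _∉_)
open import Data.List.Membership.Propositional.Properties using (∈-++⁻)
open import Data.List.Relation.Unary.Any using (here; there)
open import Data.List.Relation.Unary.All as All using (All)
open import Data.List.Relation.Unary.AllPairs as AllPairs using (AllPairs; []; _∷_)
import Data.List.Relation.Unary.AllPairs.Properties as AllPairs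
open import Data.Maybe using (just)
open import Data.Product using (_×_; _,_)
open import Data.Sum using (_⊎_; inj₁; inj₂; [_,_]′)
open import Data.Empty using (⊥-elim)
open import Data.Rational using (ℚ; _>_; _<_)
open import Function using (_$_)
open import Level using (0ℓ)
open import Relation.Binary.Core using (Rel)
open import Relation.Nullary using (yes; no)
open import Relation.Binary.PropositionalEquality using (_≡_; _≢_; refl; sym; subst)
open import Relation.Binary.Construct.Closure.ReflexiveTransitive using (ε; _◅_)

last-∈ : ∀ {a} {A : Set a} {xs : List A} {y} → last xs ≡ just y → y ∈ xs
last-∈ {xs = _ ∷ []}    refl = here refl
last-∈ {xs = _ ∷ _ ∷ _} eq   = there (last-∈ eq)

module _ {a ℓ} {A : Set a} {R : Rel A ℓ} where

  AllPairs-last : ∀ {xs : List A} {y e} → AllPairs R xs → last xs ≡ just y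
                → e ∈ xs → e ≢ y → R e y
  AllPairs-last {_ ∷ []}    _            refl (here refl)  e≢y = ⊥-elim (e≢y refl)
  AllPairs-last {_ ∷ _ ∷ _} (rs ∷ _)     eq   (here refl)  _   = All.lookup rs (last-∈ eq)
  AllPairs-last {_ ∷ _ ∷ _} (_ ∷ sorted) eq   (there e∈xs) e≢y = AllPairs-last sorted eq e∈xs e≢y

  AllPairs-snoc : ∀ {xs : List A} {y} → AllPairs R xs → (∀ e → e ∈ xs → R e y)
                → AllPairs R (xs ++ [ y ])
  AllPairs-snoc sorted below =
    AllPairs.++⁺ sorted (All.[] ∷ []) (All.map (All._∷ All.[]) (All.tabulate (below _)))

module Invariant (S : Setting) where
  open PPSO S

  Buffers : Set
  Buffers = Tid → VarG → List Entry

  _≺_ : Rel Entry 0ℓ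
  e ≺ e′ = ts e < ts e′

  record Valid (b : Buffers) : Set where
    field
      sorted       : ∀ t x → AllPairs _≺_ (b t x)
      stamp-unique : ∀ {t₁ x₁ t₂ x₂ v₁ v₂ q} → (v₁ , q) ∈ b t₁ x₁ → (v₂ , q) ∈ b t₂ x₂
                   → t₁ ≡ t₂ × x₁ ≡ x₂
  open Valid

  updWB-elim : ∀ (P : Tid → VarG → List Entry → Set) {b t x w}
             → P t x w → (∀ t′ y → P t′ y (b t′ y))
             → ∀ t′ y → P t′ y (updWB b t x w t′ y)
  updWB-elim P {t = t} {x} pw pb t′ y with t′ ≟t t | y ≟x x
  ... | yes refl | yes refl = pw
  ... | yes _    | no _     = pb t′ y
  ... | no _     | _        = pb t′ y

  ∈-updWB⁻ : ∀ {b t x w t′ y e} → e ∈ updWB b t x w t′ y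
           → e ∈ b t′ y ⊎ (t′ ≡ t × y ≡ x × e ∈ w)
  ∈-updWB⁻ {b} {t} {x} {w} {t′} {y} {e} =
    updWB-elim (λ t′ y l → e ∈ l → e ∈ b t′ y ⊎ (t′ ≡ t × y ≡ x × e ∈ w))
               (λ e∈w → inj₂ (refl , refl , e∈w)) (λ _ _ → inj₁) t′ y

  ∈-append⁻ : ∀ {b t x e₀ t′ y e} → e ∈ updWB b t x (b t x ++ [ e₀ ]) t′ y
            → e ∈ b t′ y ⊎ (t′ ≡ t × y ≡ x × e ≡ e₀)
  ∈-append⁻ {b} {t} {x} e∈ with ∈-updWB⁻ {b} e∈
  ... | inj₁ old = inj₁ old
  ... | inj₂ (refl , refl , e∈w) with ∈-++⁻ (b t x) e∈w
  ...   | inj₁ old         = inj₁ old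
  ...   | inj₂ (here e≡e₀) = inj₂ (refl , refl , e≡e₀)

  valid-write : ∀ {b t x v q}
              → (∀ t′ x′ v′ → (v′ , q) ∉ b t′ x′) → (∀ e → e ∈ b t x → ts e < q)
              → Valid b → Valid (updWB b t x (b t x ++ [ (v , q) ]))
  valid-write {b} {t} {x} {v} {q} fresh below valid = record
    { sorted       = updWB-elim (λ _ _ → AllPairs _≺_)
                                (AllPairs-snoc (sorted valid t x) below) (sorted valid)
    ; stamp-unique = unique
    }
    where
      b′ : Buffers
      b′ = updWB b t x (b t x ++ [ (v , q) ])

      unique : ∀ {t₁ x₁ t₂ x₂ v₁ v₂ q′} → (v₁ , q′) ∈ b′ t₁ x₁ → (v₂ , q′) ∈ b′ t₂ x₂
             → t₁ ≡ t₂ × x₁ ≡ x₂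
      unique e₁∈ e₂∈ with ∈-append⁻ {b} e₁∈ | ∈-append⁻ {b} e₂∈
      ... | inj₁ old₁              | inj₁ old₂              = stamp-unique valid old₁ old₂
      ... | inj₁ old₁              | inj₂ (_ , _ , refl)    = ⊥-elim (fresh _ _ _ old₁)
      ... | inj₂ (_ , _ , refl)    | inj₁ old₂              = ⊥-elim (fresh _ _ _ old₂)
      ... | inj₂ (refl , refl , _) | inj₂ (refl , refl , _) = refl , refl

  valid-flush : ∀ {t σ σ′} → Flush t σ σ′ → Valid (wb σ) → Valid (wb σ′)
  valid-flush {t} {σ} (pp-flush {x = x} {w = w} buffer≡ _) valid = record
    { sorted       = updWB-elim (λ _ _ → AllPairs _≺_)
                                (AllPairs.tail (subst (AllPairs _≺_) buffer≡ (sorted valid t x)))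
                                (sorted valid)
    ; stamp-unique = λ e₁∈ e₂∈ → stamp-unique valid (shrinks e₁∈) (shrinks e₂∈)
    }
    where
      shrinks : ∀ {t′ y e} → e ∈ updWB (wb σ) t x w t′ y → e ∈ wb σ t′ y
      shrinks e∈ with ∈-updWB⁻ {wb σ} e∈
      ... | inj₁ old                 = old
      ... | inj₂ (refl , refl , e∈w) = subst (_ ∈_) (sym buffer≡) (there e∈w)

  valid-flushes : ∀ {σ σ′} → FL σ σ′ → Valid (wb σ) → Valid (wb σ′)
  valid-flushes ε                  valid = valid
  valid-flushes ((_ , flush) ◅ fl) valid = valid-flushes fl (valid-flush flush valid)

  valid-step : ∀ {t a σ σ′} → Step t a σ σ′ → Valid (wb σ) → Valid (wb σ′)
  valid-step (pp-write _ fresh below) = valid-write fresh below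
  valid-step (pp-read _)              = λ valid → valid
  valid-step (pp-fence _)             = λ valid → valid

  valid-run : ∀ {σ α σ′} → Run σ α σ′ → Valid (wb σ) → Valid (wb σ′)
  valid-run done                       valid = valid
  valid-run (step _ (_ , fl , st) run) valid = valid-run run (valid-step st (valid-flushes fl valid))

  valid-initial : ∀ {σ} → I σ → Valid (wb σ)
  valid-initial empty = record
    { sorted       = λ t x → subst (AllPairs _≺_) (sym (empty t x)) []
    ; stamp-unique = λ {t₁} {x₁} e∈ → ⊥-elim (∉[] (subst (_ ∈_) (empty t₁ x₁) e∈))
    }
    where
      ∉[] : ∀ {e : Entry} → e ∉ []
      ∉[] ()

lemma4 : (S : Setting) → let open PPSO S in
    ∀ (t : Tid) (x : VarG) (σ₀ σ : State) (α : List Act)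
    → traces α → I σ₀ → Run σ₀ α σ
    → ∀ (v : Val) (q : ℚ) → last (wb σ t x) ≡ just (v , q)
    → (∀ (t' : Tid) (x' : VarG) → (t' ≢ t ⊎ x' ≢ x) → ∀ (v' : Val) → (v' , q) ∉ wb σ t' x')
    × (∀ (e : Entry) → e ∈ wb σ t x → e ≢ (v , q) → q > ts e)
lemma4 S t x σ₀ σ α _ initial run v q last≡ =
  (λ t′ x′ elsewhere v′ e∈ →
     let (t′≡t , x′≡x) = stamp-unique e∈ (last-∈ last≡)
     in [ _$ t′≡t , _$ x′≡x ]′ elsewhere)
  , λ e e∈ e≢last → AllPairs-last (sorted t x) last≡ e∈ e≢last
  where
    open Invariant S
    open Valid (valid-run run (valid-initial {σ₀} initial))
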